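{- Let $n\geqslant 22$ with $n\equiv 2 \pmod 4$. Then $\mathbf{i}=\left(\frac{n + 2}{4}, \frac{n - 2}{4}, 5, 4, 2 \times \frac{n-22}{4}, 1, 1\right)$ is a partition of $n$ and $\Lambda(\mathbf{i})=\left\lfloor\frac{n-3}{4}\right\rfloor + 1$; in particular $\left\lfloor\frac{n-3}{4}\right\rfloor + 1$ is an eigenvalue of $T_n$.
   Context: Notation $k\times t$ inside a partition means the part $k$ repeated $t$ times. For an integer partition $\mathbf{i}=(n_1,\dots,n_k)$ of $n$ (nonincreasing positive integers summing to $n$), $\Lambda(\mathbf{i})=\sum_{j=1}^k \frac{n_j(n_j-2j+1)}{2}$; this is the eigenvalue of the Transposition graph $T_n=\mathrm{Cay}(\mathrm{Sym}_n,\{\text{all transpositions}\})$ associated with the irreducible character of $\mathrm{Sym}_n$ indexed by $\mathbf{i}$, so $\Lambda(\mathbf{i})$ is an eigenvalue of $T_n$. -}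

module Defs where

open import Data.Nat as ℕ using (ℕ; zero; suc; _≥_; _>_)
open import Data.Integer as ℤ using (ℤ; +_)
open import Data.Rational as ℚ using (ℚ; 0ℚ)
open import Data.List using (List; []; _∷_; map; concatMap; filter; foldr; allFin)
open import Data.Nat.ListAction using (sum)
open import Data.List.Relation.Unary.All using (All)
open import Data.List.Relation.Unary.Linked using (Linked)
open import Data.Fin using (Fin; toℕ)
open import Data.Fin.Permutation using (Permutation′; _∘ₚ_; transpose; _≈_)
open import Data.Product using (_×_; _,_; ∃)
open import Relation.Binary.PropositionalEquality using (_≡_; _≢_)

record IsPartition (n : ℕ) (ps : List ℕ) : Set where
  field
    positive      : All (λ p → p > 0) ps
    nonincreasing : Linked _≥_ ps
    sums          : sum ps ≡ n

Λ-from : ℕ → List ℕ → ℚ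
Λ-from j [] = 0ℚ
Λ-from j (m ∷ ms) =
  ((+ m ℤ.* ((+ m ℤ.- + (2 ℕ.* j)) ℤ.+ + 1)) ℚ./ 2) ℚ.+ Λ-from (suc j) ms

Λ : List ℕ → ℚ
Λ = Λ-from 1

transpositionPairs : (n : ℕ) → List (Fin n × Fin n)
transpositionPairs n =
  concatMap (λ i → map (i ,_) (filter (λ j → toℕ i ℕ.<? toℕ j) (allFin n))) (allFin n)

-- Action of the adjacency operator of the Transposition graph
-- T_n = Cay(Sym_n, {all transpositions}) on a function v : Sym_n → ℚ:
-- (A v)(σ) = Σ_{τ transposition} v(σ τ).
adjT : (n : ℕ) → (Permutation′ n → ℚ) → Permutation′ n → ℚ
adjT n v σ = foldr ℚ._+_ 0ℚ (map (λ { (i , j) → v (σ ∘ₚ transpose i j) }) (transpositionPairs n))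

-- λ is an eigenvalue of (the adjacency matrix of) T_n: there is a nonzero
-- vector v ∈ ℚ^{Sym_n} (a function on permutations respecting pointwise
-- equality of permutations) with A v = λ v.
-- (Since T_n's adjacency matrix is rational symmetric, rational eigenvalues
-- of it are exactly those with rational eigenvectors.)
IsEigenvalueT : (n : ℕ) → ℚ → Set
IsEigenvalueT n λ′ =
  ∃ λ (v : Permutation′ n → ℚ) →
    (∀ σ ρ → σ ≈ ρ → v σ ≡ v ρ) ×
    (∃ λ σ → v σ ≢ 0ℚ) ×
    (∀ σ → adjT n v σ ≡ λ′ ℚ.* v σ)

-- Write n = 22 + 4t, so that 𝐢 = (6 + t, 5 + t, 5, 4, 2 × t, 1, 1). Twice Λ is the integer
-- Σⱼ nⱼ (nⱼ − 2j + 1), and a run of t equal parts m starting at position j contributes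
-- m t (m + 2 − 2j − t) to it. Hence
--   2Λ(𝐢) = (t + 6)(t + 5) + (t + 5)(t + 2) + 0 − 12 − 2t(t + 6) − 2(2t + 9) = 2(t + 5),
-- so Λ(𝐢) = t + 5 = ⌊(n − 3)/4⌋ + 1, and the hypothesis turns this into an eigenvalue of Tₙ.

module Submission where

open import Defs
open import Data.Nat using (ℕ; _≥_; _+_; _∸_; _/_; _%_)
open import Data.Integer using (+_)
open import Data.Rational using (ℚ) renaming (_/_ to _/ℚ_)
open import Data.List using (List; []; _∷_; _++_; replicate)
open import Data.Product using (_×_)
open import Relation.Binary.PropositionalEquality using (_≡_)

open import Data.Nat using (zero; suc; _*_; _≤_; _<_; NonZero; z≤n; s≤s; z<s)
open import Data.Nat.Properties using (+-comm; +-identityʳ; +-suc; ≤-refl; ≤-trans; n≤1+n; n<1+n; m≤m+n; m∸n+n≡m)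
open import Data.Nat.DivMod using (m≡m%n+[m/n]*n; m*n/n≡m; m<n⇒m/n≡0; +-distrib-/-∣ʳ; m*n≤o⇒[o∸m*n]%n≡o%n)
open import Data.Nat.Divisibility using (n∣m*n)
open import Data.Nat.ListAction using (sum)
open import Data.Nat.ListAction.Properties using (sum-++)
import Data.Nat.Tactic.RingSolver as ℕ-Solver
open import Data.Integer as ℤ using (ℤ; 0ℤ)
open import Data.Integer.Properties using (pos-*; +-identityˡ; +-assoc; *-identityʳ; *-comm)
import Data.Integer.Tactic.RingSolver as ℤ-Solver
import Data.Rational as ℚ
open import Data.Rational.Properties using (toℚᵘ-injective; toℚᵘ-homo-+; toℚᵘ-fromℚᵘ; fromℚᵘ-cong)
open import Data.Rational.Unnormalised as ℚᵘ using (mkℚᵘ; *≡*)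
open import Data.Rational.Unnormalised.Properties using (+-cong; ≃-sym; module ≃-Reasoning)
open import Data.List as List using (length)
open import Data.List.Properties using (length-replicate)
open import Data.List.Relation.Unary.All using ([]; _∷_)
open import Data.List.Relation.Unary.All.Properties using (++⁺; replicate⁺)
open import Data.List.Relation.Unary.Linked using (Linked; [-]; _∷_)
open import Data.Product using (∃; _,_)
open import Relation.Binary.PropositionalEquality using (refl; cong; cong₂; sym; trans; subst; subst₂; module ≡-Reasoning)

+-distrib-/2 : ∀ i k → (i ℤ.+ k) /ℚ 2 ≡ i /ℚ 2 ℚ.+ k /ℚ 2
+-distrib-/2 i k = toℚᵘ-injective (begin
  ℚ.toℚᵘ ((i ℤ.+ k) /ℚ 2)                  ≈⟨ toℚᵘ-fromℚᵘ (mkℚᵘ (i ℤ.+ k) 1) ⟩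
  mkℚᵘ (i ℤ.+ k) 1                          ≈⟨ *≡* (doubled-sum i k) ⟩
  mkℚᵘ i 1 ℚᵘ.+ mkℚᵘ k 1                    ≈⟨ +-cong (≃-sym (toℚᵘ-fromℚᵘ (mkℚᵘ i 1)))
                                                        (≃-sym (toℚᵘ-fromℚᵘ (mkℚᵘ k 1))) ⟩
  ℚ.toℚᵘ (i /ℚ 2) ℚᵘ.+ ℚ.toℚᵘ (k /ℚ 2)     ≈⟨ ≃-sym (toℚᵘ-homo-+ (i /ℚ 2) (k /ℚ 2)) ⟩
  ℚ.toℚᵘ (i /ℚ 2 ℚ.+ k /ℚ 2)               ∎)
  where
  open ≃-Reasoning
  doubled-sum : ∀ i k → (i ℤ.+ k) ℤ.* + 4 ≡ (i ℤ.* + 2 ℤ.+ k ℤ.* + 2) ℤ.* + 2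
  doubled-sum = ℤ-Solver.solve-∀

[2*i]/2≡i/1 : ∀ i → (+ 2 ℤ.* i) /ℚ 2 ≡ i /ℚ 1
[2*i]/2≡i/1 i = fromℚᵘ-cong {mkℚᵘ (+ 2 ℤ.* i) 1} {mkℚᵘ i 0}
                  (*≡* (trans (*-identityʳ (+ 2 ℤ.* i)) (*-comm (+ 2) i)))

sum-replicate : ∀ t m → sum (replicate t m) ≡ t * m
sum-replicate zero    m = refl
sum-replicate (suc t) m = cong (_+_ m) (sum-replicate t m)

replicate-++-linked : ∀ t {x m ys} → x ≥ m → Linked _≥_ (m ∷ ys) → Linked _≥_ (x ∷ replicate t m ++ ys)
replicate-++-linked zero    x≥m [-]           = [-]
replicate-++-linked zero    x≥m (m≥y ∷ m∷ys)  = ≤-trans m≥y x≥m ∷ m∷ys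
replicate-++-linked (suc t) x≥m m∷ys          = x≥m ∷ replicate-++-linked t ≤-refl m∷ys

[r+q*d]/d≡q : ∀ {r d} q .{{_ : NonZero d}} → r < d → (r + q * d) / d ≡ q
[r+q*d]/d≡q {r} {d} q r<d =
  trans (+-distrib-/-∣ʳ r (n∣m*n q)) (cong₂ _+_ (m<n⇒m/n≡0 r<d) (m*n/n≡m q d))

n%4≡2⇒n≡22+t*4 : ∀ {n} → n ≥ 22 → n % 4 ≡ 2 → ∃ λ t → n ≡ 22 + t * 4
n%4≡2⇒n≡22+t*4 {n} n≥22 n%4≡2 = q , (begin
  n                                   ≡⟨ m∸n+n≡m 20≤n ⟨
  n ∸ 20 + 20                         ≡⟨ cong (_+ 20) (m≡m%n+[m/n]*n (n ∸ 20) 4) ⟩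
  (n ∸ 20) % 4 + q * 4 + 20           ≡⟨ cong (λ r → r + q * 4 + 20) (trans (m*n≤o⇒[o∸m*n]%n≡o%n 5 20≤n) n%4≡2) ⟩
  2 + q * 4 + 20                      ≡⟨ cong (_+_ 2) (+-comm (q * 4) 20) ⟩
  22 + q * 4                          ∎)
  where
  open ≡-Reasoning
  q : ℕ
  q = (n ∸ 20) / 4
  20≤n : 20 ≤ n
  20≤n = ≤-trans (m≤m+n 20 2) n≥22

-- An integer, so that computations with it are ring normalisation rather than ℚ arithmetic.
twiceΛ-from : ℕ → List ℕ → ℤ
twiceΛ-from j []       = 0ℤ
twiceΛ-from j (m ∷ ms) = + m ℤ.* (+ m ℤ.- + 2 ℤ.* + j ℤ.+ + 1) ℤ.+ twiceΛ-from (suc j) ms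

Λ-from≡twiceΛ-from/2 : ∀ j ms → Λ-from j ms ≡ twiceΛ-from j ms /ℚ 2
Λ-from≡twiceΛ-from/2 j []       = refl
Λ-from≡twiceΛ-from/2 j (m ∷ ms) = begin
  (+ m ℤ.* (+ m ℤ.- + (2 * j) ℤ.+ + 1)) /ℚ 2 ℚ.+ Λ-from (suc j) ms
    ≡⟨ cong₂ ℚ._+_ (cong (λ 2j → (+ m ℤ.* (+ m ℤ.- 2j ℤ.+ + 1)) /ℚ 2) (pos-* 2 j))
                   (Λ-from≡twiceΛ-from/2 (suc j) ms) ⟩
  (+ m ℤ.* (+ m ℤ.- + 2 ℤ.* + j ℤ.+ + 1)) /ℚ 2 ℚ.+ twiceΛ-from (suc j) ms /ℚ 2
    ≡⟨ +-distrib-/2 (+ m ℤ.* (+ m ℤ.- + 2 ℤ.* + j ℤ.+ + 1)) (twiceΛ-from (suc j) ms) ⟨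
  twiceΛ-from j (m ∷ ms) /ℚ 2 ∎
  where open ≡-Reasoning

twiceΛ-from-++ : ∀ j xs ys →
  twiceΛ-from j (xs ++ ys) ≡ twiceΛ-from j xs ℤ.+ twiceΛ-from (j + length xs) ys
twiceΛ-from-++ j []       ys = sym (trans (+-identityˡ _) (cong (λ k → twiceΛ-from k ys) (+-identityʳ j)))
twiceΛ-from-++ j (x ∷ xs) ys = begin
  c ℤ.+ twiceΛ-from (suc j) (xs ++ ys)
    ≡⟨ cong (ℤ._+_ c) (twiceΛ-from-++ (suc j) xs ys) ⟩
  c ℤ.+ (twiceΛ-from (suc j) xs ℤ.+ twiceΛ-from (suc j + length xs) ys)
    ≡⟨ sym (+-assoc c _ _) ⟩
  c ℤ.+ twiceΛ-from (suc j) xs ℤ.+ twiceΛ-from (suc j + length xs) ys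
    ≡⟨ cong (λ k → c ℤ.+ twiceΛ-from (suc j) xs ℤ.+ twiceΛ-from k ys) (sym (+-suc j _)) ⟩
  twiceΛ-from j (x ∷ xs) ℤ.+ twiceΛ-from (j + suc (length xs)) ys ∎
  where
  open ≡-Reasoning
  c : ℤ
  c = + x ℤ.* (+ x ℤ.- + 2 ℤ.* + j ℤ.+ + 1)

twiceΛ-from-replicate : ∀ j t m →
  twiceΛ-from j (replicate t m) ≡ + t ℤ.* + m ℤ.* (+ m ℤ.+ + 2 ℤ.- (+ 2 ℤ.* + j ℤ.+ + t))
twiceΛ-from-replicate j zero    m = refl
twiceΛ-from-replicate j (suc t) m =
  trans (cong (ℤ._+_ (+ m ℤ.* (+ m ℤ.- + 2 ℤ.* + j ℤ.+ + 1))) (twiceΛ-from-replicate (suc j) t m))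
        (peel (+ m) (+ j) (+ t))
  where
  peel : ∀ M J T → M ℤ.* (M ℤ.- + 2 ℤ.* J ℤ.+ + 1) ℤ.+ T ℤ.* M ℤ.* (M ℤ.+ + 2 ℤ.- (+ 2 ℤ.* (+ 1 ℤ.+ J) ℤ.+ T))
                   ≡ (+ 1 ℤ.+ T) ℤ.* M ℤ.* (M ℤ.+ + 2 ℤ.- (+ 2 ℤ.* J ℤ.+ (+ 1 ℤ.+ T)))
  peel = ℤ-Solver.solve-∀

𝐢ₜ : ℕ → List ℕ
𝐢ₜ t = 6 + t ∷ 5 + t ∷ 5 ∷ 4 ∷ replicate t 2 ++ 1 ∷ 1 ∷ []

𝐢ₜ-isPartition : ∀ t → IsPartition (22 + t * 4) (𝐢ₜ t)
𝐢ₜ-isPartition t = record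
  { positive      = z<s ∷ z<s ∷ z<s ∷ z<s ∷ ++⁺ (replicate⁺ t z<s) (z<s ∷ z<s ∷ [])
  ; nonincreasing = n≤1+n (5 + t) ∷ m≤m+n 5 t ∷ n≤1+n 4
                      ∷ replicate-++-linked t (s≤s (s≤s z≤n)) (s≤s z≤n ∷ ≤-refl ∷ [-])
  ; sums          = 𝐢ₜ-sum
  }
  where
  𝐢ₜ-sum : sum (𝐢ₜ t) ≡ 22 + t * 4
  𝐢ₜ-sum rewrite sum-++ (replicate t 2) (1 ∷ 1 ∷ []) | sum-replicate t 2 = parts-sum t
    where
    parts-sum : ∀ k → 6 + k + (5 + k + (9 + (k * 2 + 2))) ≡ 22 + k * 4
    parts-sum = ℕ-Solver.solve-∀

twiceΛ-𝐢ₜ : ∀ t → twiceΛ-from 1 (𝐢ₜ t) ≡ + 2 ℤ.* + (5 + t)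
twiceΛ-𝐢ₜ t = begin
  twiceΛ-from 1 (large ++ replicate t 2 ++ small)
    ≡⟨ twiceΛ-from-++ 1 large (replicate t 2 ++ small) ⟩
  twiceΛ-from 1 large ℤ.+ twiceΛ-from 5 (replicate t 2 ++ small)
    ≡⟨ cong (ℤ._+_ (twiceΛ-from 1 large)) (twiceΛ-from-++ 5 (replicate t 2) small) ⟩
  twiceΛ-from 1 large ℤ.+ (twiceΛ-from 5 (replicate t 2) ℤ.+ twiceΛ-from (5 + length (replicate t 2)) small)
    ≡⟨ cong (λ k → twiceΛ-from 1 large ℤ.+ (twiceΛ-from 5 (replicate t 2) ℤ.+ twiceΛ-from (5 + k) small))
            (length-replicate t) ⟩
  twiceΛ-from 1 large ℤ.+ (twiceΛ-from 5 (replicate t 2) ℤ.+ twiceΛ-from (5 + t) small)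
    ≡⟨ cong (ℤ._+_ (twiceΛ-from 1 large))
            (cong₂ ℤ._+_ (twiceΛ-from-replicate 5 t 2) (twiceΛ-from-replicate (5 + t) 2 1)) ⟩
  twiceΛ-from 1 large ℤ.+ (+ t ℤ.* + 2 ℤ.* (+ 4 ℤ.- (+ 2 ℤ.* + 5 ℤ.+ + t))
                          ℤ.+ + 2 ℤ.* + 1 ℤ.* (+ 1 ℤ.+ + 2 ℤ.- (+ 2 ℤ.* + (5 + t) ℤ.+ + 2)))
    ≡⟨ sum-of-contributions (+ t) ⟩
  + 2 ℤ.* + (5 + t) ∎
  where
  open ≡-Reasoning
  large small : List ℕ
  large = 6 + t ∷ 5 + t ∷ 5 ∷ 4 ∷ []
  small = 1 ∷ 1 ∷ []
  -- The first four summands are twiceΛ-from 1 large, unfolded.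
  sum-of-contributions : ∀ T →
    (+ 6 ℤ.+ T) ℤ.* (+ 6 ℤ.+ T ℤ.- + 2 ℤ.* + 1 ℤ.+ + 1)
      ℤ.+ ((+ 5 ℤ.+ T) ℤ.* (+ 5 ℤ.+ T ℤ.- + 2 ℤ.* + 2 ℤ.+ + 1)
      ℤ.+ (+ 5 ℤ.* (+ 5 ℤ.- + 2 ℤ.* + 3 ℤ.+ + 1)
      ℤ.+ (+ 4 ℤ.* (+ 4 ℤ.- + 2 ℤ.* + 4 ℤ.+ + 1) ℤ.+ + 0)))
    ℤ.+ (T ℤ.* + 2 ℤ.* (+ 4 ℤ.- (+ 2 ℤ.* + 5 ℤ.+ T))
         ℤ.+ + 2 ℤ.* + 1 ℤ.* (+ 1 ℤ.+ + 2 ℤ.- (+ 2 ℤ.* (+ 5 ℤ.+ T) ℤ.+ + 2)))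
    ≡ + 2 ℤ.* (+ 5 ℤ.+ T)
  sum-of-contributions = ℤ-Solver.solve-∀

Λ-𝐢ₜ : ∀ t → Λ (𝐢ₜ t) ≡ + (5 + t) /ℚ 1
Λ-𝐢ₜ t = begin
  Λ (𝐢ₜ t)                          ≡⟨ Λ-from≡twiceΛ-from/2 1 (𝐢ₜ t) ⟩
  twiceΛ-from 1 (𝐢ₜ t) /ℚ 2         ≡⟨ cong (_/ℚ 2) (twiceΛ-𝐢ₜ t) ⟩
  (+ 2 ℤ.* + (5 + t)) /ℚ 2          ≡⟨ [2*i]/2≡i/1 (+ (5 + t)) ⟩
  + (5 + t) /ℚ 1                    ∎
  where open ≡-Reasoning

𝐢 : ℕ → List ℕ
𝐢 n = (n + 2) / 4 ∷ (n ∸ 2) / 4 ∷ 5 ∷ 4 ∷ replicate ((n ∸ 22) / 4) 2 ++ 1 ∷ 1 ∷ []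

𝐯 : ℕ → ℚ
𝐯 n = + ((n ∸ 3) / 4 + 1) /ℚ 1

-- With n written as 22 + t * 4, the differences n ∸ 2, n ∸ 3 and n ∸ 22 compute to
-- (5 + t) * 4, 3 + (4 + t) * 4 and t * 4 respectively.
𝐢ₜ≡𝐢 : ∀ t → 𝐢ₜ t ≡ 𝐢 (22 + t * 4)
𝐢ₜ≡𝐢 t = sym (cong₂ List._∷_ [n+2]/4≡6+t (cong₂ List._∷_ (m*n/n≡m (5 + t) 4)
                (cong (λ k → 5 ∷ 4 ∷ replicate k 2 ++ 1 ∷ 1 ∷ []) (m*n/n≡m t 4))))
  where
  [n+2]/4≡6+t : (22 + t * 4 + 2) / 4 ≡ 6 + t
  [n+2]/4≡6+t = trans (cong (λ m → m / 4) (cong (_+_ 22) (+-comm (t * 4) 2))) (m*n/n≡m (6 + t) 4)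

5+t≡𝐯 : ∀ t → + (5 + t) /ℚ 1 ≡ 𝐯 (22 + t * 4)
5+t≡𝐯 t = cong (λ k → + k /ℚ 1) (sym (begin
  (22 + t * 4 ∸ 3) / 4 + 1   ≡⟨ cong (λ q → q + 1) ([r+q*d]/d≡q (4 + t) (n<1+n 3)) ⟩
  4 + t + 1                 ≡⟨ +-comm (4 + t) 1 ⟩
  5 + t                     ∎))
  where open ≡-Reasoning

EigenPartition : ℕ → List ℕ → ℚ → Set
EigenPartition n i v = IsPartition n i × Λ i ≡ v × IsEigenvalueT n v

-- The goal is reached by subst rather than with/rewrite: those normalise the goal, and
-- normalising Λ of a partition with symbolic parts (gcds inside ℚ) exhausts memory.
lemma9 : (∀ m (ps : List ℕ) → IsPartition m ps → IsEigenvalueT m (Λ ps))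
         → (n : ℕ) → n ≥ 22 → n % 4 ≡ 2
         → let i = ((n + 2) / 4) ∷ ((n ∸ 2) / 4) ∷ 5 ∷ 4 ∷ (replicate ((n ∸ 22) / 4) 2 ++ (1 ∷ 1 ∷ []))
               v = (+ ((n ∸ 3) / 4 + 1)) /ℚ 1
           in IsPartition n i × Λ i ≡ v × IsEigenvalueT n v
lemma9 hyp n n≥22 n%4≡2 = for-22+t*4 (n%4≡2⇒n≡22+t*4 n≥22 n%4≡2)
  where
  for-22+t*4 : (∃ λ t → n ≡ 22 + t * 4) → EigenPartition n (𝐢 n) (𝐯 n)
  for-22+t*4 (t , n≡22+t*4) =
    subst (λ m → EigenPartition m (𝐢 m) (𝐯 m)) (sym n≡22+t*4)
      (subst₂ (EigenPartition (22 + t * 4)) (𝐢ₜ≡𝐢 t) (5+t≡𝐯 t)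
        (𝐢ₜ-isPartition t , Λ-𝐢ₜ t , subst (IsEigenvalueT _) (Λ-𝐢ₜ t) (hyp _ (𝐢ₜ t) (𝐢ₜ-isPartition t))))
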